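{- Let $G$ be a graph and $G'$ a blow-up of $G$. Then the maximum size of an acyclic matching of $G$ equals the maximum size of an acyclic matching of $G'$.
   Context: All graphs are finite and simple. A blow-up of a graph $G$ is a graph obtained from $G$ by a finite sequence of the following operation: choose a vertex $v$, replace $v$ by a nonempty independent set $A_v$ of new vertices, and join every vertex of $A_v$ to every neighbor of $v$. A matching $M$ (set of pairwise nonadjacent edges) is acyclic if the subgraph induced on the endpoints of the edges of $M$ is acyclic. -}

module Defs where

open import Data.Nat using (ℕ; _≤_; _≥_)
open import Data.Fin using (Fin)
open import Data.Bool using (Bool; true; false)
open import Data.List using (List; []; _∷_; length; concatMap; head; last)
open import Data.List.Relation.Unary.All using (All)
open import Data.List.Relation.Unary.Unique.Propositional using (Unique)
open import Data.List.Membership.Propositional using (_∈_)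
open import Data.Maybe using (Maybe; just; nothing)
open import Data.Product using (Σ; ∃; _×_; _,_)
open import Relation.Binary.PropositionalEquality using (_≡_; _≢_)
open import Relation.Binary.Construct.Closure.ReflexiveTransitive using (Star)
open import Relation.Nullary using (¬_)
open import Data.Empty using (⊥)

record Graph : Set where
  field
    n      : ℕ
    adj    : Fin n → Fin n → Bool
    sym    : ∀ x y → adj x y ≡ adj y x
    irrefl : ∀ x → adj x x ≡ false
open Graph public

Adj : (G : Graph) → Fin (n G) → Fin (n G) → Set
Adj G x y = adj G x y ≡ true

endpoints : {m : ℕ} → List (Fin m × Fin m) → List (Fin m)
endpoints = concatMap (λ { (x , y) → x ∷ y ∷ [] })

IsMatching : (G : Graph) → List (Fin (n G) × Fin (n G)) → Set
IsMatching G M = All (λ { (x , y) → Adj G x y }) M × Unique (endpoints M)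

data Path (G : Graph) : List (Fin (n G)) → Set where
  single : ∀ x → Path G (x ∷ [])
  step   : ∀ x y vs → Adj G x y → Path G (y ∷ vs) → Path G (x ∷ y ∷ vs)

IsCycle : (G : Graph) → List (Fin (n G)) → Set
IsCycle G []       = ⊥
IsCycle G (v ∷ vs) =
  (length (v ∷ vs) ≥ 3) × Unique (v ∷ vs) × Path G (v ∷ vs) ×
  Σ (Fin (n G)) (λ w → (last (v ∷ vs) ≡ just w) × Adj G w v)

InducedAcyclic : (G : Graph) → List (Fin (n G)) → Set
InducedAcyclic G S = ∀ C → IsCycle G C → ¬ All (_∈ S) C

IsAcyclicMatching : (G : Graph) → List (Fin (n G) × Fin (n G)) → Set
IsAcyclicMatching G M = IsMatching G M × InducedAcyclic G (endpoints M)

IsMaxAcyclicMatchingSize : Graph → ℕ → Set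
IsMaxAcyclicMatchingSize G m =
  (Σ _ λ M → IsAcyclicMatching G M × length M ≡ m) ×
  (∀ M → IsAcyclicMatching G M → length M ≤ m)

-- One blow-up step (up to isomorphism of the result): H arises from G by replacing
-- vertex v by a nonempty independent set A_v = f⁻¹(v), every other vertex w being
-- kept as the unique vertex of f⁻¹(w), with adjacency inherited through f
-- (so A_v is independent since G has no loops, and A_v is joined to N_G(v)).
BlowupStep : Graph → Graph → Set
BlowupStep G H =
  Σ (Fin (n G)) λ v → Σ (Fin (n H) → Fin (n G)) λ f →
    (∃ λ x → f x ≡ v) ×
    (∀ w → w ≢ v → (∃ λ x → f x ≡ w) × (∀ x y → f x ≡ w → f y ≡ w → x ≡ y)) ×
    (∀ x y → adj H x y ≡ adj G (f x) (f y))

Blowup : Graph → Graph → Set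
Blowup = Star BlowupStep

{-# OPTIONS --safe #-}
-- A blow-up step G ⇝ H comes with a surjection f from the vertices of H onto those of G,
-- injective off A_v = f⁻¹(v), through which H inherits its adjacency. Every section of f
-- embeds G as an induced subgraph of H, so it carries acyclic matchings of G to acyclic
-- matchings of H of the same size. Conversely f carries an acyclic matching M of H to one
-- of G: the vertices of A_v are pairwise twins, and two distinct twins x, x' covered by M,
-- matched to u, u', would span the 4-cycle x u x' u' inside M. So M covers at most one
-- vertex of A_v, f is injective on the endpoints of M, and a section of f through that
-- vertex pulls every cycle on the image back to a cycle on the endpoints of M.
module Submission where

open import Defs
open import Data.Nat using (ℕ; _≤_; s≤s; z≤n)
open import Data.Fin using (Fin; _≟_)
open import Data.List using (List; []; _∷_; length; map; last)
open import Data.List.Properties using (length-map; last-map)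
open import Data.List.Relation.Unary.All as All using (All; []; _∷_)
import Data.List.Relation.Unary.All.Properties as AllP
open import Data.List.Relation.Unary.Any as Any using (here; there; any?)
open import Data.List.Relation.Unary.AllPairs using ([]; _∷_)
open import Data.List.Relation.Unary.Unique.Propositional using (Unique)
open import Data.List.Membership.Propositional using (_∈_; _∉_; find; lose)
open import Data.List.Membership.Propositional.Properties
  using (∈-map⁻; ∈-concatMap⁺; ∈-concatMap⁻)
open import Data.Maybe using (just)
import Data.Maybe as Maybe
open import Data.Product as Product using (∃; _×_; _,_; proj₁; proj₂)
open import Data.Sum using (_⊎_; inj₁; inj₂)
open import Data.Empty using (⊥-elim)
open import Function using (_∘_)
open import Function.Bundles using (_⇔_; mk⇔)
import Function.Properties.Equivalence as ⇔
open import Relation.Nullary.Decidable using (yes; no; decidable-stable)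
open import Relation.Binary.PropositionalEquality
  using (_≡_; _≢_; refl; trans; cong; cong₂; subst) renaming (sym to ≡-sym)
open import Relation.Binary.Construct.Closure.ReflexiveTransitive using (fold)

Unique-map⁺ : {A B : Set} {f : A → B} (g : B → A) {xs : List A} →
  All (λ x → g (f x) ≡ x) xs → Unique xs → Unique (map f xs)
Unique-map⁺ g [] [] = []
Unique-map⁺ {f = f} g {x ∷ _} (gfx ∷ gfxs) (x∉ ∷ xs!) =
  AllP.map⁺ (All.zipWith fx≢fy (gfxs , x∉)) ∷ Unique-map⁺ g gfxs xs!
  where
  fx≢fy : ∀ {y} → g (f y) ≡ y × x ≢ y → f x ≢ f y
  fx≢fy (gfy , x≢y) fx≡fy = x≢y (trans (≡-sym gfx) (trans (cong g fx≡fy) gfy))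

last-∈ : {A : Set} (xs : List A) {w : A} → last xs ≡ just w → w ∈ xs
last-∈ []           ()
last-∈ (x ∷ [])     refl = here refl
last-∈ (x ∷ y ∷ xs) eq   = there (last-∈ (y ∷ xs) eq)

mapEdges : {p q : ℕ} → (Fin p → Fin q) → List (Fin p × Fin p) → List (Fin q × Fin q)
mapEdges φ = map (Product.map φ φ)

endpoints-mapEdges : {p q : ℕ} (φ : Fin p → Fin q) (M : List (Fin p × Fin p)) →
  endpoints (mapEdges φ M) ≡ map φ (endpoints M)
endpoints-mapEdges φ []            = refl
endpoints-mapEdges φ ((a , b) ∷ M) = cong (λ l → φ a ∷ φ b ∷ l) (endpoints-mapEdges φ M)

module _ {S T : Graph} (φ : Fin (n S) → Fin (n T)) (ψ : Fin (n T) → Fin (n S))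
         (adj-φ : ∀ a b → adj T (φ a) (φ b) ≡ adj S a b) where

  Adj-ψ : ∀ {a b} → φ (ψ a) ≡ a → φ (ψ b) ≡ b → Adj T a b → Adj S (ψ a) (ψ b)
  Adj-ψ {a} {b} φψa φψb a~b =
    trans (≡-sym (adj-φ (ψ a) (ψ b))) (trans (cong₂ (adj T) φψa φψb) a~b)

  Path-map : ∀ {C} → All (λ c → φ (ψ c) ≡ c) C → Path T C → Path S (map ψ C)
  Path-map (_ ∷ [])         (single x)           = single (ψ x)
  Path-map (φψx ∷ φψy ∷ φψC) (step x y vs x~y p) =
    step (ψ x) (ψ y) (map ψ vs) (Adj-ψ φψx φψy x~y) (Path-map (φψy ∷ φψC) p)

  IsCycle-map : ∀ C → All (λ c → φ (ψ c) ≡ c) C → IsCycle T C → IsCycle S (map ψ C)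
  IsCycle-map (v ∷ vs) φψC (3≤len , C! , path , w , last≡w , w~v) =
    subst (3 ≤_) (≡-sym (length-map ψ (v ∷ vs))) 3≤len ,
    Unique-map⁺ φ φψC C! ,
    Path-map φψC path ,
    ψ w , trans (last-map ψ (v ∷ vs)) (cong (Maybe.map ψ) last≡w) ,
    Adj-ψ (All.lookup φψC (last-∈ (v ∷ vs) last≡w)) (All.head φψC) w~v

  mapEdges-isAcyclicMatching : ∀ M → All (λ a → ψ (φ a) ≡ a) (endpoints M) →
    IsAcyclicMatching S M → IsAcyclicMatching T (mapEdges φ M)
  mapEdges-isAcyclicMatching M ψφ ((M-adj , M!) , M-acyclic) =
    (AllP.map⁺ (All.map (λ { {a , b} a~b → trans (adj-φ a b) a~b }) M-adj) ,
     subst Unique (≡-sym (endpoints-mapEdges φ M)) (Unique-map⁺ ψ ψφ M!)) ,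
    λ C C-cycle C⊆ → M-acyclic (map ψ C)
      (IsCycle-map C (All.map (proj₁ ∘ pull) C⊆) C-cycle)
      (AllP.map⁺ (All.map (proj₂ ∘ pull) C⊆))
    where
    pull : ∀ {c} → c ∈ endpoints (mapEdges φ M) → φ (ψ c) ≡ c × ψ c ∈ endpoints M
    pull c∈ with ∈-map⁻ φ (subst (_ ∈_) (endpoints-mapEdges φ M) c∈)
    ... | s , s∈ , refl =
      cong φ (All.lookup ψφ s∈) , subst (_∈ endpoints M) (≡-sym (All.lookup ψφ s∈)) s∈

module _ {k : ℕ} where

  private variable
    M : List (Fin k × Fin k)
    p q p′ q′ x x′ u z : Fin k

  MatchedTo : List (Fin k × Fin k) → Fin k → Fin k → Set
  MatchedTo M x u = (x , u) ∈ M ⊎ (u , x) ∈ M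

  ∈-endpoints : (p , q) ∈ M → z ∈ p ∷ q ∷ [] → z ∈ endpoints M
  ∈-endpoints e∈ z∈ = ∈-concatMap⁺ _ (Any.map (λ { refl → z∈ }) e∈)

  covered⇒matched : x ∈ endpoints M → ∃ (MatchedTo M x)
  covered⇒matched {M = M} x∈ with find (∈-concatMap⁻ _ {xs = M} x∈)
  ... | (p , q) , e∈ , here refl         = q , inj₁ e∈
  ... | (p , q) , e∈ , there (here refl) = p , inj₂ e∈

  matched⇒covered : MatchedTo M x u → u ∈ endpoints M
  matched⇒covered (inj₁ e∈) = ∈-endpoints e∈ (there (here refl))
  matched⇒covered (inj₂ e∈) = ∈-endpoints e∈ (here refl)

  edges-sharing-endpoint : Unique (endpoints M) →
    (p , q) ∈ M → (p′ , q′) ∈ M → z ∈ p ∷ q ∷ [] → z ∈ p′ ∷ q′ ∷ [] → (p , q) ≡ (p′ , q′)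
  edges-sharing-endpoint _ (here refl) (here refl) _ _ = refl
  edges-sharing-endpoint M! (here refl) (there e∈) z∈ z∈′ =
    ⊥-elim (head-∉ M! z∈ (∈-endpoints e∈ z∈′))
    where
    head-∉ : ∀ {p q z zs} → Unique (p ∷ q ∷ zs) → z ∈ p ∷ q ∷ [] → z ∉ zs
    head-∉ (p∉ ∷ _)      (here refl)         z∈zs = All.lookup p∉ (there z∈zs) refl
    head-∉ (_ ∷ q∉ ∷ _) (there (here refl)) z∈zs = All.lookup q∉ z∈zs refl
  edges-sharing-endpoint M! (there e∈) (here refl) z∈ z∈′ =
    ≡-sym (edges-sharing-endpoint M! (here refl) (there e∈) z∈′ z∈)
  edges-sharing-endpoint (_ ∷ _ ∷ M!) (there e∈) (there e∈′) z∈ z∈′ =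
    edges-sharing-endpoint M! e∈ e∈′ z∈ z∈′

  matchedTo-injective : Unique (endpoints M) →
    MatchedTo M x u → MatchedTo M x′ u → x ≡ x′
  matchedTo-injective M! (inj₁ e∈) (inj₁ e∈′) =
    cong proj₁ (edges-sharing-endpoint M! e∈ e∈′ (there (here refl)) (there (here refl)))
  matchedTo-injective M! (inj₁ e∈) (inj₂ e∈′) =
    let xu≡ux′ = edges-sharing-endpoint M! e∈ e∈′ (there (here refl)) (here refl)
    in trans (cong proj₁ xu≡ux′) (cong proj₂ xu≡ux′)
  matchedTo-injective M! (inj₂ e∈) (inj₁ e∈′) =
    let ux≡x′u = edges-sharing-endpoint M! e∈ e∈′ (here refl) (there (here refl))
    in trans (cong proj₂ ux≡x′u) (cong proj₁ ux≡x′u)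
  matchedTo-injective M! (inj₂ e∈) (inj₂ e∈′) =
    cong proj₂ (edges-sharing-endpoint M! e∈ e∈′ (here refl) (here refl))

module _ (H : Graph) where

  Adj-sym : ∀ {x y} → Adj H x y → Adj H y x
  Adj-sym {x} {y} x~y = trans (Graph.sym H y x) x~y

  Adj⇒≢ : ∀ {x y} → Adj H x y → x ≢ y
  Adj⇒≢ {x} x~y refl with trans (≡-sym x~y) (irrefl H x)
  ... | ()

  matchedTo⇒Adj : ∀ {M x u} → IsMatching H M → MatchedTo M x u → Adj H x u
  matchedTo⇒Adj (M-adj , _) (inj₁ e∈) = All.lookup M-adj e∈
  matchedTo⇒Adj (M-adj , _) (inj₂ e∈) = Adj-sym (All.lookup M-adj e∈)

  square-isCycle : ∀ {x y z w} → Adj H x y → Adj H y z → Adj H z w → Adj H w x →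
    x ≢ z → y ≢ w → IsCycle H (x ∷ y ∷ z ∷ w ∷ [])
  square-isCycle x~y y~z z~w w~x x≢z y≢w =
    s≤s (s≤s (s≤s z≤n)) ,
    (Adj⇒≢ x~y ∷ x≢z ∷ Adj⇒≢ (Adj-sym w~x) ∷ []) ∷ (Adj⇒≢ y~z ∷ y≢w ∷ []) ∷
      (Adj⇒≢ z~w ∷ []) ∷ [] ∷ [] ,
    step _ _ _ x~y (step _ _ _ y~z (step _ _ _ z~w (single _))) ,
    _ , refl , w~x

  Twins : Fin (n H) → Fin (n H) → Set
  Twins x x′ = ∀ y → adj H x y ≡ adj H x′ y

  acyclicMatching-covers-one-twin : ∀ {M x x′} → IsAcyclicMatching H M → Twins x x′ →
    x ∈ endpoints M → x′ ∈ endpoints M → x ≡ x′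
  acyclicMatching-covers-one-twin {M} {x} {x′} (matching , acyclic) twins x∈ x′∈ =
    decidable-stable (x ≟ x′) λ x≢x′ →
      acyclic (x ∷ u ∷ x′ ∷ u′ ∷ [])
        (square-isCycle x~u u~x′ x′~u′ u′~x x≢x′ λ u≡u′ →
          x≢x′ (matchedTo-injective (proj₂ matching) xu (subst (MatchedTo M x′) (≡-sym u≡u′) x′u′)))
        (x∈ ∷ matched⇒covered xu ∷ x′∈ ∷ matched⇒covered x′u′ ∷ [])
    where
    u = proj₁ (covered⇒matched {M = M} x∈)
    xu = proj₂ (covered⇒matched {M = M} x∈)
    u′ = proj₁ (covered⇒matched {M = M} x′∈)
    x′u′ = proj₂ (covered⇒matched {M = M} x′∈)
    x~u = matchedTo⇒Adj matching xu
    x′~u′ = matchedTo⇒Adj matching x′u′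
    u~x′ = Adj-sym (trans (≡-sym (twins u)) x~u)
    u′~x = Adj-sym (trans (twins u′) x′~u′)

AcyclicMatchingsEmbed : Graph → Graph → Set
AcyclicMatchingsEmbed G H =
  ∀ M → IsAcyclicMatching G M → ∃ λ M′ → IsAcyclicMatching H M′ × length M′ ≡ length M

isMaxAcyclicMatchingSize-⇔ : ∀ {G H} → AcyclicMatchingsEmbed G H → AcyclicMatchingsEmbed H G →
  ∀ m → IsMaxAcyclicMatchingSize G m ⇔ IsMaxAcyclicMatchingSize H m
isMaxAcyclicMatchingSize-⇔ G↪H H↪G m = mk⇔ (transport G↪H H↪G) (transport H↪G G↪H)
  where
  transport : ∀ {G H} → AcyclicMatchingsEmbed G H → AcyclicMatchingsEmbed H G →
    IsMaxAcyclicMatchingSize G m → IsMaxAcyclicMatchingSize H m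
  transport G↪H H↪G ((M , M-am , refl) , maximal) =
    G↪H M M-am ,
    λ N N-am → let (N′ , N′-am , N′-len) = H↪G N N-am in
      subst (_≤ length M) N′-len (maximal N′ N′-am)

module BlowupStepMap (G H : Graph) (v : Fin (n G)) (f : Fin (n H) → Fin (n G))
  (preimage : ∀ w → w ≢ v → (∃ λ x → f x ≡ w) × (∀ x y → f x ≡ w → f y ≡ w → x ≡ y))
  (adj-f : ∀ x y → adj H x y ≡ adj G (f x) (f y)) where

  section : Fin (n H) → Fin (n G) → Fin (n H)
  section x₀ w with w ≟ v
  ... | yes _   = x₀
  ... | no w≢v = proj₁ (proj₁ (preimage w w≢v))

  f-section : ∀ {x₀} → f x₀ ≡ v → ∀ w → f (section x₀ w) ≡ w
  f-section fx₀ w with w ≟ v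
  ... | yes refl = fx₀
  ... | no w≢v  = proj₂ (proj₁ (preimage w w≢v))

  section-f : ∀ x₀ s → (f s ≡ v → s ≡ x₀) → section x₀ (f s) ≡ s
  section-f x₀ s onlyx₀ with f s ≟ v
  ... | yes fs  = ≡-sym (onlyx₀ fs)
  ... | no fs≢v = proj₂ (preimage (f s) fs≢v) _ _ (proj₂ (proj₁ (preimage (f s) fs≢v))) refl

  fibre-twins : ∀ {x x′} → f x ≡ v → f x′ ≡ v → Twins H x x′
  fibre-twins {x} {x′} fx fx′ y =
    trans (adj-f x y) (trans (cong (λ a → adj G a (f y)) (trans fx (≡-sym fx′))) (≡-sym (adj-f x′ y)))

  G↪H : ∀ {x₀} → f x₀ ≡ v → AcyclicMatchingsEmbed G H
  G↪H {x₀} fx₀ M M-am =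
    mapEdges (section x₀) M ,
    mapEdges-isAcyclicMatching (section x₀) f adj-section M (All.tabulate λ _ → f-section fx₀ _) M-am ,
    length-map _ M
    where
    adj-section : ∀ a b → adj H (section x₀ a) (section x₀ b) ≡ adj G a b
    adj-section a b = trans (adj-f _ _) (cong₂ (adj G) (f-section fx₀ a) (f-section fx₀ b))

  covered-fibre-representative : Fin (n H) → ∀ M → IsAcyclicMatching H M →
    ∃ λ x → ∀ {s} → s ∈ endpoints M → f s ≡ v → s ≡ x
  covered-fibre-representative x₀ M M-am with any? (λ x → f x ≟ v) (endpoints M)
  ... | yes covered = let (x , x∈ , fx) = find covered in
    x , λ s∈ fs → acyclicMatching-covers-one-twin H M-am (fibre-twins fs fx) s∈ x∈
  ... | no uncovered = x₀ , λ s∈ fs → ⊥-elim (uncovered (lose s∈ fs))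

  H↪G : Fin (n H) → AcyclicMatchingsEmbed H G
  H↪G x₀ M M-am =
    let (x , onlyx) = covered-fibre-representative x₀ M M-am in
    mapEdges f M ,
    mapEdges-isAcyclicMatching f (section x) (λ a b → ≡-sym (adj-f a b)) M
      (All.tabulate λ s∈ → section-f x _ (onlyx s∈)) M-am ,
    length-map _ M

blowupStep-isMaxAcyclicMatchingSize-⇔ : ∀ {G H} → BlowupStep G H →
  ∀ m → IsMaxAcyclicMatchingSize G m ⇔ IsMaxAcyclicMatchingSize H m
blowupStep-isMaxAcyclicMatchingSize-⇔ {G} {H} (v , f , (x₀ , fx₀) , preimage , adj-f) =
  isMaxAcyclicMatchingSize-⇔ (G↪H fx₀) (H↪G x₀)
  where open BlowupStepMap G H v f preimage adj-f

proposition4 : (G G' : Graph) → Blowup G G' → (m : ℕ) →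
    IsMaxAcyclicMatchingSize G m ⇔ IsMaxAcyclicMatchingSize G' m
proposition4 G G' =
  fold (λ G H → ∀ m → IsMaxAcyclicMatchingSize G m ⇔ IsMaxAcyclicMatchingSize H m)
    (λ step blowup m → ⇔.trans (blowupStep-isMaxAcyclicMatchingSize-⇔ step m) (blowup m))
    (λ m → ⇔.refl)
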